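{- For a set $S$, let $G_S$ be the set-system hypergraph with $V(G_S)=S$, $E(G_S)=\{1\}$ and $\epsilon_{G_S}(1)=S$, and let $V^{\diamond}(\{1\})$ be the set-system hypergraph with one vertex and no edges. The class $\mathscr{G}:=\{G_S:S\text{ a set}\}\cup\{V^{\diamond}(\{1\})\}$ is a family of generators for $\mathfrak{H}$. If $\mathscr{J}$ is any family of generators for $\mathfrak{H}$, then $\mathscr{J}$ is a proper class. Consequently, $\mathscr{G}$ is a minimal family of generators.
   Context: A set-system hypergraph $G$ consists of sets $V(G)$, $E(G)$ and a function $\epsilon_G:E(G)\to\mathcal{P}(V(G))$ (edges may be empty). A morphism $\phi:G\to H$ is a pair of functions $V(\phi):V(G)\to V(H)$, $E(\phi):E(G)\to E(H)$ with $\epsilon_H\circ E(\phi)=\mathcal{P}V(\phi)\circ\epsilon_G$, where $\mathcal{P}f(A)=\{f(a):a\in A\}$. This forms the category $\mathfrak{H}$. A family $\mathscr{J}$ of objects is a family of generators if for any parallel morphisms $\phi\neq\psi:X\to Y$ there exist $J\in\mathscr{J}$ and $\varphi:J\to X$ with $\phi\circ\varphi\neq\psi\circ\varphi$. -}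

module Defs where

open import Level using (Level; suc)
open import Data.Product using (Σ; ∃; _×_; _,_)
open import Data.Maybe using (Maybe; just; nothing)
open import Data.Unit.Polymorphic using (⊤)
open import Data.Empty.Polymorphic using (⊥)
open import Relation.Unary using (Pred; _∈_; _≐_)
open import Relation.Binary.PropositionalEquality using (_≡_)
open import Relation.Nullary using (¬_)

record Hypergraph (ℓ : Level) : Set (suc ℓ) where
  field
    V : Set ℓ
    E : Set ℓ
    ε : E → Pred V ℓ
open Hypergraph public

image : ∀ {ℓ} {A B : Set ℓ} → (A → B) → Pred A ℓ → Pred B ℓ
image {A = A} f S b = ∃ λ (a : A) → (a ∈ S) × (f a ≡ b)

record Hom {ℓ} (G H : Hypergraph ℓ) : Set (suc ℓ) where
  field
    Vmap : V G → V H
    Emap : E G → E H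
    comm : ∀ (e : E G) → ε H (Emap e) ≐ image Vmap (ε G e)
open Hom public

_≈ₕ_ : ∀ {ℓ} {G H : Hypergraph ℓ} → Hom G H → Hom G H → Set ℓ
φ ≈ₕ ψ = (∀ v → Vmap φ v ≡ Vmap ψ v) × (∀ e → Emap φ e ≡ Emap ψ e)

_∘ₕ_ : ∀ {ℓ} {G H K : Hypergraph ℓ} → Hom H K → Hom G H → Hom G K
Vmap (φ ∘ₕ ψ) v = Vmap φ (Vmap ψ v)
Emap (φ ∘ₕ ψ) e = Emap φ (Emap ψ e)
comm (_∘ₕ_ {G = G} {H} {K} φ ψ) e =
  (λ {k} k∈ → go k∈) , λ { (v , v∈ , refl') → back v v∈ refl' }
  where
  open import Relation.Binary.PropositionalEquality using (refl; subst)
  go : ∀ {k} → k ∈ ε K (Emap φ (Emap ψ e)) → k ∈ image (λ v → Vmap φ (Vmap ψ v)) (ε G e)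
  go k∈ with Data.Product.proj₁ (comm φ (Emap ψ e)) k∈
  ... | h , h∈ , refl with Data.Product.proj₁ (comm ψ e) h∈
  ...   | v , v∈ , refl = v , v∈ , refl
  back : ∀ {k} v → v ∈ ε G e → Vmap φ (Vmap ψ v) ≡ k → k ∈ ε K (Emap φ (Emap ψ e))
  back v v∈ refl = Data.Product.proj₂ (comm φ (Emap ψ e))
    (Vmap ψ v , Data.Product.proj₂ (comm ψ e) (v , v∈ , refl) , refl)

IsFamilyOfGenerators : ∀ {ℓ ι} {I : Set ι} → (I → Hypergraph ℓ) → Set (Level._⊔_ (suc ℓ) ι)
IsFamilyOfGenerators {ℓ} {I = I} J =
  ∀ (X Y : Hypergraph ℓ) (φ ψ : Hom X Y) → ¬ (φ ≈ₕ ψ) →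
    Σ I λ j → Σ (Hom (J j) X) λ ϕ → ¬ ((φ ∘ₕ ϕ) ≈ₕ (ψ ∘ₕ ϕ))

G[_] : ∀ {ℓ} → Set ℓ → Hypergraph ℓ
V (G[ S ]) = S
E (G[ S ]) = ⊤
ε (G[ S ]) _ _ = ⊤

V◇1 : ∀ {ℓ} → Hypergraph ℓ
V V◇1 = ⊤
E V◇1 = ⊥
ε V◇1 ()

-- The class 𝒢 = { G_S : S a set } ∪ { V^◇({1}) }, indexed by Maybe (Set ℓ)
-- (a large index type).
𝒢 : ∀ {ℓ} → Maybe (Set ℓ) → Hypergraph ℓ
𝒢 (just S) = G[ S ]
𝒢 nothing  = V◇1

module Submission where

-- Both halves rest on how morphisms out of the two kinds of
-- object in 𝒢 look.
--   • A morphism V◇1 → X is a choice of a vertex of X, and the inclusion of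
--     the vertex set of an edge e gives a morphism G[ S ] → X hitting e.
--     Classically, two distinct parallel morphisms differ on some vertex or
--     on some edge; precomposing with the corresponding point or edge
--     separates them, so 𝒢 is a family of generators.
--   • Conversely, given a set-indexed family J, take S = (i : I) → V(J i) → Bool
--     and the two morphisms G[ S ] → G₂[ S ] (two full edges on S) that differ
--     only on the edge.  A separating J j must have an edge, and any morphism
--     J j → G[ S ] is then onto on vertices (the edge's image is all of S),
--     which Cantor's diagonal argument forbids; so no set-indexed family
--     generates.  Excluded middle is used for the case split in the first
--     half and to decide equality of indices in the diagonal argument.

open import Defs
open import Level using (Level; Lift; lift)
open import Data.Bool using (Bool; true; false; not)
open import Data.Bool.Properties using (not-¬)
open import Data.Empty using (⊥-elim)
open import Data.Maybe using (just; nothing)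
open import Data.Product using (_×_; _,_; Σ; ∃; proj₁; proj₂)
open import Data.Sum using (_⊎_; inj₁; inj₂)
open import Data.Unit.Polymorphic using (⊤; tt)
open import Function.Definitions using (StrictlySurjective)
open import Relation.Binary.Definitions using (DecidableEquality)
open import Relation.Binary.PropositionalEquality using (_≡_; _≢_; refl; cong; trans)
open import Relation.Nullary using (¬_; yes; no)
open import Axiom.ExcludedMiddle using (ExcludedMiddle)
open import Axiom.DoubleNegationElimination using (em⇒dne)

private
  variable
    ℓ : Level

¬×⇒¬⊎¬ : ExcludedMiddle ℓ → {A B : Set ℓ} → ¬ (A × B) → ¬ A ⊎ ¬ B
¬×⇒¬⊎¬ em {A} ¬ab with em {A}
... | yes a  = inj₂ λ b → ¬ab (a , b)
... | no ¬a  = inj₁ ¬a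

counterexample : ExcludedMiddle ℓ → {A : Set ℓ} {P : A → Set ℓ} →
                 ¬ (∀ x → P x) → ∃ λ x → ¬ P x
counterexample em ¬∀ = dne λ ¬∃ → ¬∀ λ x → dne λ ¬Px → ¬∃ (x , ¬Px)
  where dne = em⇒dne em

disagreement : ExcludedMiddle ℓ → {X Y : Hypergraph ℓ} {φ ψ : Hom X Y} → ¬ (φ ≈ₕ ψ) →
               (∃ λ v → Vmap φ v ≢ Vmap ψ v) ⊎ (∃ λ e → Emap φ e ≢ Emap ψ e)
disagreement em φ≉ψ with ¬×⇒¬⊎¬ em φ≉ψ
... | inj₁ ¬agreeV = inj₁ (counterexample em ¬agreeV)
... | inj₂ ¬agreeE = inj₂ (counterexample em ¬agreeE)

pointAt : (X : Hypergraph ℓ) → V X → Hom V◇1 X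
Vmap (pointAt X v) _ = v
Emap (pointAt X v) ()
comm (pointAt X v) ()

VerticesOf : (X : Hypergraph ℓ) → E X → Set ℓ
VerticesOf X e = Σ (V X) (ε X e)

edgeAt : (X : Hypergraph ℓ) (e : E X) → Hom G[ VerticesOf X e ] X
Vmap (edgeAt X e) = proj₁
Emap (edgeAt X e) _ = e
comm (edgeAt X e) _ = (λ {v} v∈e → (v , v∈e) , tt , refl)
                    , λ { ((v , v∈e) , _ , refl) → v∈e }

𝒢-generates : ExcludedMiddle ℓ → IsFamilyOfGenerators (𝒢 {ℓ})
𝒢-generates em X Y φ ψ φ≉ψ with disagreement em {φ = φ} {ψ} φ≉ψ
... | inj₁ (v , φv≢ψv) = nothing , pointAt X v , λ agree → φv≢ψv (proj₁ agree tt)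
... | inj₂ (e , φe≢ψe) = just (VerticesOf X e) , edgeAt X e , λ agree → φe≢ψe (proj₂ agree tt)

module _ {ι a} {I : Set ι} (_≟_ : DecidableEquality I) (F : I → Set a) where

  diagonal : (j : I) → (F j → (i : I) → F i → Bool) → (i : I) → F i → Bool
  diagonal j f i x with i ≟ j
  ... | yes refl = not (f x j x)
  ... | no _     = true

  diagonal-at : ∀ j f (x : F j) → diagonal j f j x ≡ not (f x j x)
  diagonal-at j f x with j ≟ j
  ... | yes refl = refl
  ... | no j≢j   = ⊥-elim (j≢j refl)

  cantor : (j : I) (f : F j → (i : I) → F i → Bool) → ¬ StrictlySurjective _≡_ f
  cantor j f onto with onto (diagonal j f)
  ... | x , fx≡diagonal = not-¬ refl (trans (cong (λ g → g j x) fx≡diagonal) (diagonal-at j f x))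

-- A morphism into G[ S ] is onto on vertices as soon as its source has an
-- edge, since that edge must be sent to the full edge S.
onto-G : {H : Hypergraph ℓ} {S : Set ℓ} (ϕ : Hom H G[ S ]) → E H →
         StrictlySurjective _≡_ (Vmap ϕ)
onto-G ϕ e s with proj₁ (comm ϕ e) {s} tt
... | x , _ , ϕx≡s = x , ϕx≡s

G₂[_] : Set ℓ → Hypergraph ℓ
V G₂[ S ] = S
E (G₂[_] {ℓ} S) = Lift ℓ Bool
ε G₂[ S ] _ _ = ⊤

onEdge : {S : Set ℓ} → Lift ℓ Bool → Hom G[ S ] G₂[ S ]
Vmap (onEdge b) s = s
Emap (onEdge b) _ = b
comm (onEdge b) _ = (λ {s} _ → s , tt , refl) , λ _ → tt

onEdge-distinct : {S : Set ℓ} → ¬ (onEdge {S = S} (lift true) ≈ₕ onEdge (lift false))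
onEdge-distinct agree with proj₂ agree tt
... | ()

-- Only a hypergraph with an edge can separate the two: they agree on vertices,
-- so precomposites can differ only on edges.
separator-has-edge : {H : Hypergraph ℓ} {S : Set ℓ} (ϕ : Hom H G[ S ]) →
                     ¬ ((onEdge (lift true) ∘ₕ ϕ) ≈ₕ (onEdge (lift false) ∘ₕ ϕ)) → ¬ ¬ E H
separator-has-edge ϕ separated noEdge = separated ((λ _ → refl) , λ e → ⊥-elim (noEdge e))

Codes : (I : Set ℓ) → (I → Hypergraph ℓ) → Set ℓ
Codes I J = (i : I) → V (J i) → Bool

no-small-generators : ExcludedMiddle ℓ → (I : Set ℓ) (J : I → Hypergraph ℓ) →
                      ¬ IsFamilyOfGenerators J
no-small-generators em I J generates
  with generates G[ Codes I J ] G₂[ Codes I J ] (onEdge (lift true)) (onEdge (lift false))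
                 onEdge-distinct
... | j , ϕ , separated =
  separator-has-edge ϕ separated λ e → cantor (λ _ _ → em) (λ i → V (J i)) j (Vmap ϕ) (onto-G ϕ e)

mainTheorem7 : ∀ {ℓ : Level} → ExcludedMiddle ℓ →
    IsFamilyOfGenerators (𝒢 {ℓ})
      × (∀ (I : Set ℓ) (J : I → Hypergraph ℓ) → ¬ IsFamilyOfGenerators J)
mainTheorem7 em = 𝒢-generates em , no-small-generators em
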